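{- Let $k$ be an even positive integer such that $5k+3$ is prime. If $k\equiv 1\pmod 3$ and the number $\frac{2(5k+4)}{3}$ is a period of the Fibonacci sequence modulo $5k+3$, then the following three congruences are equivalent: $$F_{5k+4}\equiv 0\pmod{5k+3},\qquad F_{\frac{5k+4}{3}}\equiv 0\pmod{5k+3},\qquad F_{\frac{2(5k+4)}{3}}\equiv 0\pmod{5k+3}.$$ Moreover, if $k\equiv 1\pmod 3$ and $F_{\frac{5k+4}{3}}\equiv 0\pmod{5k+3}$, then the number $\frac{2(5k+4)}{3}$ is a period of the Fibonacci sequence modulo $5k+3$ if and only if $F_{\frac{5k+1}{3}}\equiv -1\pmod{5k+3}$.
   Context: $(F_n)_{n\ge 0}$ denotes the Fibonacci sequence: $F_0=0$, $F_1=1$, $F_{n+2}=F_{n+1}+F_n$. For an integer $m\ge 2$, a period of the Fibonacci sequence modulo $m$ is a non-zero integer $\ell$ such that $F_{1+\ell}\equiv F_{2+\ell}\equiv 1\pmod m$. -}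

module Defs where

open import Data.Nat using (ℕ; zero; suc; _+_; _%_; NonZero)
open import Data.Product using (_×_)
open import Relation.Binary.PropositionalEquality using (_≡_)

fib : ℕ → ℕ
fib zero = 0
fib (suc zero) = 1
fib (suc (suc n)) = fib (suc n) + fib n

infix 4 _≡_[mod_]

_≡_[mod_] : ℕ → ℕ → (m : ℕ) → .{{NonZero m}} → Set
a ≡ b [mod m ] = a % m ≡ b % m

IsFibPeriod : (m : ℕ) → .{{NonZero m}} → ℕ → Set
IsFibPeriod m ℓ = (fib (1 + ℓ) ≡ 1 [mod m ]) × (fib (2 + ℓ) ≡ 1 [mod m ])

{-# OPTIONS --safe #-}
module Submission where

-- Write p = 5k + 3 and m = (5k + 1)/3, so that p = 3m + 2, (5k + 4)/3 = m + 1 and the candidate period is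
-- 2(m + 1). In ℤ[ζ] with ζ a primitive fifth root of unity, φ = −ζ² − ζ³ is the golden ratio and
-- φ^(n+1) = F n + F (n+1) φ. As p ≡ 3 (mod 10), the freshman's dream gives φ^p ≡ (−ζ²)³ + (−ζ³)³ = 1 − φ
-- (mod p), i.e. F (p−1) ≡ 1 and F p ≡ −1, hence F (p+1) ≡ 0. If 2(m + 1) is a period, shifting by it gives
-- F (m+1) ≡ F (p+1) ≡ 0 and F m ≡ F p ≡ −1, and F (2m+2) = F (m+1) (F (m+2) + F m) ≡ 0, so all three
-- congruences hold. Conversely, F (m+1) ≡ 0 and F m ≡ −1 give F (2m+3) = F (m+2)² + F (m+1)² ≡ F m² ≡ 1 and
-- F (2m+4) = F (2m+3) + F (2m+2) ≡ 1, so 2(m + 1) is a period.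

open import Algebra.Bundles using (CommutativeSemiring)
open import Data.Product using (_,_; proj₁; proj₂; ∃-syntax)
open import Data.Sum using (inj₁; inj₂)
open import Function.Base using (const)
open import Function.Bundles using (_⇔_; mk⇔)
open import Relation.Binary.PropositionalEquality as ≡ using (_≡_)
open import Data.Nat using (ℕ; zero; suc; NonZero)
open import Defs

module PrimeBinomial where
  open import Data.Nat as ℕ using (ℕ; zero; suc; _<_; _∸_; _!; NonZero)
  open import Data.Nat.Combinatorics using (_C_; nCk≡n!/k![n-k]!; k![n∸k]!∣n!)
  open import Data.Nat.Divisibility using (_∣_; _∤_; ∣1⇒≡1; ∣⇒≤; ∣m⇒∣m*n; ∣-refl)
  open import Data.Nat.DivMod using (m/n*n≡m)
  open import Data.Nat.Primality using (Prime; euclidsLemma; ¬prime[1])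
  import Data.Nat.Properties as ℕP
  open import Data.Nat.Properties using (_!*_!≢0)
  open import Relation.Nullary using (contradiction)

  prime∤! : ∀ {p m} → Prime p → m < p → p ∤ m !
  prime∤! {m = zero} p-prime _ p∣1 = ¬prime[1] (≡.subst Prime (∣1⇒≡1 p∣1) p-prime)
  prime∤! {m = suc m} p-prime 1+m<p p∣[1+m]! with euclidsLemma (suc m) (m !) p-prime p∣[1+m]!
  ... | inj₁ p∣1+m = ℕP.<⇒≱ 1+m<p (∣⇒≤ p∣1+m)
  ... | inj₂ p∣m! = prime∤! p-prime (ℕP.<-trans (ℕP.n<1+n m) 1+m<p) p∣m!

  p∣pCk : ∀ {p k} → Prime p → 0 < k → k < p → p ∣ p C k
  p∣pCk {suc p} {k} p-prime 0<k k<p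
    with euclidsLemma (suc p C k) (k ! ℕ.* (suc p ∸ k) !) p-prime p∣pCk*k!*[p∸k]!
    where
    instance
      k!*[p∸k]!≢0 : NonZero (k ! ℕ.* (suc p ∸ k) !)
      k!*[p∸k]!≢0 = k !* (suc p ∸ k) !≢0
    pCk*k!*[p∸k]!≡p! : (suc p C k) ℕ.* (k ! ℕ.* (suc p ∸ k) !) ≡ suc p !
    pCk*k!*[p∸k]!≡p! = ≡.trans (≡.cong (ℕ._* (k ! ℕ.* (suc p ∸ k) !)) (nCk≡n!/k![n-k]! (ℕP.<⇒≤ k<p)))
                               (m/n*n≡m (k![n∸k]!∣n! (ℕP.<⇒≤ k<p)))
    p∣pCk*k!*[p∸k]! : suc p ∣ (suc p C k) ℕ.* (k ! ℕ.* (suc p ∸ k) !)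
    p∣pCk*k!*[p∸k]! = ≡.subst (suc p ∣_) (≡.sym pCk*k!*[p∸k]!≡p!) (∣m⇒∣m*n (p !) ∣-refl)
  ... | inj₁ p∣pCk = p∣pCk
  ... | inj₂ p∣k!*[p∸k]! with euclidsLemma (k !) ((suc p ∸ k) !) p-prime p∣k!*[p∸k]!
  ...   | inj₁ p∣k! = contradiction p∣k! (prime∤! p-prime k<p)
  ...   | inj₂ p∣[p∸k]! = contradiction p∣[p∸k]! (prime∤! p-prime (ℕP.∸-monoʳ-< 0<k (ℕP.<⇒≤ k<p)))


module FreshmansDream {c ℓ} (R : CommutativeSemiring c ℓ) where
  open import Data.Fin using (Fin; zero; suc; toℕ; fromℕ; inject₁)
  open import Data.Fin.Properties using (toℕ-fromℕ; inject₁ℕ<)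
  open import Data.Nat as ℕ using (ℕ; zero; suc; _∸_; s≤s; z≤n)
  open import Data.Nat.Combinatorics using (_C_; nCn≡1)
  open import Data.Nat.Divisibility using (_∣_; quotient)
  open import Data.Nat.Primality using (Prime)
  import Data.Nat.Properties as ℕP
  open import Data.Vec.Functional using (Vector)
  open PrimeBinomial using (p∣pCk)
  open CommutativeSemiring R hiding (zero)
  open import Algebra.Properties.CommutativeSemiring.Binomial R using (theorem; binomial; binomialTerm)
  open import Algebra.Properties.CommutativeMonoid.Mult +-commutativeMonoid
    using (_×_; ×-congˡ; ×-assocˡ; ×-distrib-+; ×-homo-1)
  open import Algebra.Properties.CommutativeSemigroup +-commutativeSemigroup using (x∙yz≈zx∙y)
  open import Algebra.Properties.Semiring.Exp semiring using (_^_)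
  open import Algebra.Properties.Semiring.Sum semiring using (sum; sum-init-last; sum-cong-≋)
  open import Relation.Binary.Reasoning.Setoid setoid

  ×-zeroʳ : ∀ n → n × 0# ≈ 0#
  ×-zeroʳ zero = refl
  ×-zeroʳ (suc n) = trans (+-identityˡ (n × 0#)) (×-zeroʳ n)

  ×-distrib-sum : ∀ n {k} (t : Vector Carrier k) → n × sum t ≈ sum (λ i → n × t i)
  ×-distrib-sum n {zero} t = ×-zeroʳ n
  ×-distrib-sum n {suc k} t = trans (×-distrib-+ (t zero) _ n) (+-congˡ (×-distrib-sum n (λ i → t (suc i))))

  freshman's-dream : ∀ {p} → Prime p → ∀ x y → ∃[ z ] (x + y) ^ p ≈ x ^ p + y ^ p + p × z
  freshman's-dream {suc p} p-prime x y = sum middle , (begin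
    (x + y) ^ suc p                                          ≈⟨ theorem (suc p) x y ⟩
    term zero + sum (λ i → term (suc i))                     ≈⟨ +-cong first (sum-init-last (λ i → term (suc i))) ⟩
    y ^ suc p + (sum (λ i → term (suc (inject₁ i))) + term (fromℕ (suc p)))
                                                             ≈⟨ +-congˡ (+-cong middle-terms last) ⟩
    y ^ suc p + (suc p × sum middle + x ^ suc p)             ≈⟨ x∙yz≈zx∙y _ _ _ ⟩
    x ^ suc p + y ^ suc p + suc p × sum middle               ∎)
    where
    term : Fin (suc (suc p)) → Carrier
    term = binomialTerm x y (suc p)

    first : term zero ≈ y ^ suc p
    first = trans (×-homo-1 _) (*-identityˡ _)

    last : term (fromℕ (suc p)) ≈ x ^ suc p
    last = top (toℕ (fromℕ (suc p))) (toℕ-fromℕ (suc p))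
      where
      top : ∀ k → k ≡ suc p → (suc p C k) × (x ^ k * y ^ (suc p ∸ k)) ≈ x ^ suc p
      top _ ≡.refl = begin
        (suc p C suc p) × (x ^ suc p * y ^ (p ∸ p)) ≡⟨ ≡.cong₂ (λ c e → c × (x ^ suc p * y ^ e)) (nCn≡1 (suc p)) (ℕP.n∸n≡0 p) ⟩
        1 × (x ^ suc p * 1#)                        ≈⟨ ×-homo-1 _ ⟩
        x ^ suc p * 1#                              ≈⟨ *-identityʳ _ ⟩
        x ^ suc p                                   ∎

    p∣C : ∀ (i : Fin p) → suc p ∣ suc p C suc (toℕ (inject₁ i))
    p∣C i = p∣pCk p-prime (s≤s z≤n) (s≤s (inject₁ℕ< i))

    middle : Vector Carrier p
    middle i = quotient (p∣C i) × binomial x y (suc p) (suc (inject₁ i))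

    middle-term : ∀ i → term (suc (inject₁ i)) ≈ suc p × middle i
    middle-term i = begin
      (suc p C suc (toℕ (inject₁ i))) × b ≈⟨ ×-congˡ (_∣_.equality (p∣C i)) ⟩
      (quotient (p∣C i) ℕ.* suc p) × b    ≡⟨ ≡.cong (_× b) (ℕP.*-comm (quotient (p∣C i)) (suc p)) ⟩
      (suc p ℕ.* quotient (p∣C i)) × b    ≈⟨ ×-assocˡ b (suc p) (quotient (p∣C i)) ⟨
      suc p × middle i                    ∎
      where
      b : Carrier
      b = binomial x y (suc p) (suc (inject₁ i))

    middle-terms : sum (λ i → term (suc (inject₁ i))) ≈ suc p × sum middle
    middle-terms = trans (sum-cong-≋ middle-term) (sym (×-distrib-sum (suc p) middle))

module Cyclotomic where
  open import Algebra.Structures.Biased using (isCommutativeSemiringˡ)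
  open import Data.Integer using (ℤ; +_; _+_; _*_; _-_)
  import Data.Integer.Properties as ℤP
  open import Data.Integer.Tactic.RingSolver using (solve-∀)
  open import Level using (0ℓ)
  open import Relation.Binary.PropositionalEquality

  data ℤ[ζ₅] : Set where
    mk : ℤ → ℤ → ℤ → ℤ → ℤ[ζ₅]

  -- mk a₀ a₁ a₂ a₃ is a₀ + a₁ζ + a₂ζ² + a₃ζ³ for a primitive fifth root of unity ζ. In a product,
  -- exponents add modulo 5 and ζ⁴ = −(1 + ζ + ζ² + ζ³) subtracts the ζ⁴-coefficient from each coordinate.
  ζ⁴-coefficient : ℤ → ℤ → ℤ → ℤ → ℤ → ℤ → ℤ
  ζ⁴-coefficient a₁ a₂ a₃ b₁ b₂ b₃ = a₁ * b₃ + a₂ * b₂ + a₃ * b₁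
  {-# INLINE ζ⁴-coefficient #-}

  mul₀ mul₁ mul₂ mul₃ : ℤ → ℤ → ℤ → ℤ → ℤ → ℤ → ℤ → ℤ → ℤ
  mul₀ a₀ a₁ a₂ a₃ b₀ b₁ b₂ b₃ = a₀ * b₀ + a₂ * b₃ + a₃ * b₂ - ζ⁴-coefficient a₁ a₂ a₃ b₁ b₂ b₃
  mul₁ a₀ a₁ a₂ a₃ b₀ b₁ b₂ b₃ = a₀ * b₁ + a₁ * b₀ + a₃ * b₃ - ζ⁴-coefficient a₁ a₂ a₃ b₁ b₂ b₃
  mul₂ a₀ a₁ a₂ a₃ b₀ b₁ b₂ b₃ = a₀ * b₂ + a₁ * b₁ + a₂ * b₀ - ζ⁴-coefficient a₁ a₂ a₃ b₁ b₂ b₃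
  mul₃ a₀ a₁ a₂ a₃ b₀ b₁ b₂ b₃ = a₀ * b₃ + a₁ * b₂ + a₂ * b₁ + a₃ * b₀ - ζ⁴-coefficient a₁ a₂ a₃ b₁ b₂ b₃
  {-# INLINE mul₀ #-}
  {-# INLINE mul₁ #-}
  {-# INLINE mul₂ #-}
  {-# INLINE mul₃ #-}

  -- The mulᵢ are INLINE so that the ring solver sees their arithmetic; the solver's proofs are kept
  -- opaque because unfolding them makes checking the ring laws below very slow.
  opaque
    mul₀-assoc : ∀ a₀ a₁ a₂ a₃ b₀ b₁ b₂ b₃ c₀ c₁ c₂ c₃ →
      mul₀ (mul₀ a₀ a₁ a₂ a₃ b₀ b₁ b₂ b₃) (mul₁ a₀ a₁ a₂ a₃ b₀ b₁ b₂ b₃) (mul₂ a₀ a₁ a₂ a₃ b₀ b₁ b₂ b₃) (mul₃ a₀ a₁ a₂ a₃ b₀ b₁ b₂ b₃) c₀ c₁ c₂ c₃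
      ≡ mul₀ a₀ a₁ a₂ a₃ (mul₀ b₀ b₁ b₂ b₃ c₀ c₁ c₂ c₃) (mul₁ b₀ b₁ b₂ b₃ c₀ c₁ c₂ c₃) (mul₂ b₀ b₁ b₂ b₃ c₀ c₁ c₂ c₃) (mul₃ b₀ b₁ b₂ b₃ c₀ c₁ c₂ c₃)
    mul₀-assoc = solve-∀

    mul₁-assoc : ∀ a₀ a₁ a₂ a₃ b₀ b₁ b₂ b₃ c₀ c₁ c₂ c₃ →
      mul₁ (mul₀ a₀ a₁ a₂ a₃ b₀ b₁ b₂ b₃) (mul₁ a₀ a₁ a₂ a₃ b₀ b₁ b₂ b₃) (mul₂ a₀ a₁ a₂ a₃ b₀ b₁ b₂ b₃) (mul₃ a₀ a₁ a₂ a₃ b₀ b₁ b₂ b₃) c₀ c₁ c₂ c₃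
      ≡ mul₁ a₀ a₁ a₂ a₃ (mul₀ b₀ b₁ b₂ b₃ c₀ c₁ c₂ c₃) (mul₁ b₀ b₁ b₂ b₃ c₀ c₁ c₂ c₃) (mul₂ b₀ b₁ b₂ b₃ c₀ c₁ c₂ c₃) (mul₃ b₀ b₁ b₂ b₃ c₀ c₁ c₂ c₃)
    mul₁-assoc = solve-∀

    mul₂-assoc : ∀ a₀ a₁ a₂ a₃ b₀ b₁ b₂ b₃ c₀ c₁ c₂ c₃ →
      mul₂ (mul₀ a₀ a₁ a₂ a₃ b₀ b₁ b₂ b₃) (mul₁ a₀ a₁ a₂ a₃ b₀ b₁ b₂ b₃) (mul₂ a₀ a₁ a₂ a₃ b₀ b₁ b₂ b₃) (mul₃ a₀ a₁ a₂ a₃ b₀ b₁ b₂ b₃) c₀ c₁ c₂ c₃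
      ≡ mul₂ a₀ a₁ a₂ a₃ (mul₀ b₀ b₁ b₂ b₃ c₀ c₁ c₂ c₃) (mul₁ b₀ b₁ b₂ b₃ c₀ c₁ c₂ c₃) (mul₂ b₀ b₁ b₂ b₃ c₀ c₁ c₂ c₃) (mul₃ b₀ b₁ b₂ b₃ c₀ c₁ c₂ c₃)
    mul₂-assoc = solve-∀

    mul₃-assoc : ∀ a₀ a₁ a₂ a₃ b₀ b₁ b₂ b₃ c₀ c₁ c₂ c₃ →
      mul₃ (mul₀ a₀ a₁ a₂ a₃ b₀ b₁ b₂ b₃) (mul₁ a₀ a₁ a₂ a₃ b₀ b₁ b₂ b₃) (mul₂ a₀ a₁ a₂ a₃ b₀ b₁ b₂ b₃) (mul₃ a₀ a₁ a₂ a₃ b₀ b₁ b₂ b₃) c₀ c₁ c₂ c₃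
      ≡ mul₃ a₀ a₁ a₂ a₃ (mul₀ b₀ b₁ b₂ b₃ c₀ c₁ c₂ c₃) (mul₁ b₀ b₁ b₂ b₃ c₀ c₁ c₂ c₃) (mul₂ b₀ b₁ b₂ b₃ c₀ c₁ c₂ c₃) (mul₃ b₀ b₁ b₂ b₃ c₀ c₁ c₂ c₃)
    mul₃-assoc = solve-∀

    mul₀-comm : ∀ a₀ a₁ a₂ a₃ b₀ b₁ b₂ b₃ → mul₀ a₀ a₁ a₂ a₃ b₀ b₁ b₂ b₃ ≡ mul₀ b₀ b₁ b₂ b₃ a₀ a₁ a₂ a₃
    mul₀-comm = solve-∀

    mul₁-comm : ∀ a₀ a₁ a₂ a₃ b₀ b₁ b₂ b₃ → mul₁ a₀ a₁ a₂ a₃ b₀ b₁ b₂ b₃ ≡ mul₁ b₀ b₁ b₂ b₃ a₀ a₁ a₂ a₃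
    mul₁-comm = solve-∀

    mul₂-comm : ∀ a₀ a₁ a₂ a₃ b₀ b₁ b₂ b₃ → mul₂ a₀ a₁ a₂ a₃ b₀ b₁ b₂ b₃ ≡ mul₂ b₀ b₁ b₂ b₃ a₀ a₁ a₂ a₃
    mul₂-comm = solve-∀

    mul₃-comm : ∀ a₀ a₁ a₂ a₃ b₀ b₁ b₂ b₃ → mul₃ a₀ a₁ a₂ a₃ b₀ b₁ b₂ b₃ ≡ mul₃ b₀ b₁ b₂ b₃ a₀ a₁ a₂ a₃
    mul₃-comm = solve-∀

    mul₀-identityˡ : ∀ a₀ a₁ a₂ a₃ → mul₀ (+ 1) (+ 0) (+ 0) (+ 0) a₀ a₁ a₂ a₃ ≡ a₀
    mul₀-identityˡ = solve-∀

    mul₁-identityˡ : ∀ a₀ a₁ a₂ a₃ → mul₁ (+ 1) (+ 0) (+ 0) (+ 0) a₀ a₁ a₂ a₃ ≡ a₁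
    mul₁-identityˡ = solve-∀

    mul₂-identityˡ : ∀ a₀ a₁ a₂ a₃ → mul₂ (+ 1) (+ 0) (+ 0) (+ 0) a₀ a₁ a₂ a₃ ≡ a₂
    mul₂-identityˡ = solve-∀

    mul₃-identityˡ : ∀ a₀ a₁ a₂ a₃ → mul₃ (+ 1) (+ 0) (+ 0) (+ 0) a₀ a₁ a₂ a₃ ≡ a₃
    mul₃-identityˡ = solve-∀

    mul₀-zeroˡ : ∀ a₀ a₁ a₂ a₃ → mul₀ (+ 0) (+ 0) (+ 0) (+ 0) a₀ a₁ a₂ a₃ ≡ + 0
    mul₀-zeroˡ = solve-∀

    mul₁-zeroˡ : ∀ a₀ a₁ a₂ a₃ → mul₁ (+ 0) (+ 0) (+ 0) (+ 0) a₀ a₁ a₂ a₃ ≡ + 0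
    mul₁-zeroˡ = solve-∀

    mul₂-zeroˡ : ∀ a₀ a₁ a₂ a₃ → mul₂ (+ 0) (+ 0) (+ 0) (+ 0) a₀ a₁ a₂ a₃ ≡ + 0
    mul₂-zeroˡ = solve-∀

    mul₃-zeroˡ : ∀ a₀ a₁ a₂ a₃ → mul₃ (+ 0) (+ 0) (+ 0) (+ 0) a₀ a₁ a₂ a₃ ≡ + 0
    mul₃-zeroˡ = solve-∀

    mul₀-distribʳ : ∀ a₀ a₁ a₂ a₃ b₀ b₁ b₂ b₃ c₀ c₁ c₂ c₃ →
      mul₀ (b₀ + c₀) (b₁ + c₁) (b₂ + c₂) (b₃ + c₃) a₀ a₁ a₂ a₃ ≡ mul₀ b₀ b₁ b₂ b₃ a₀ a₁ a₂ a₃ + mul₀ c₀ c₁ c₂ c₃ a₀ a₁ a₂ a₃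
    mul₀-distribʳ = solve-∀

    mul₁-distribʳ : ∀ a₀ a₁ a₂ a₃ b₀ b₁ b₂ b₃ c₀ c₁ c₂ c₃ →
      mul₁ (b₀ + c₀) (b₁ + c₁) (b₂ + c₂) (b₃ + c₃) a₀ a₁ a₂ a₃ ≡ mul₁ b₀ b₁ b₂ b₃ a₀ a₁ a₂ a₃ + mul₁ c₀ c₁ c₂ c₃ a₀ a₁ a₂ a₃
    mul₁-distribʳ = solve-∀

    mul₂-distribʳ : ∀ a₀ a₁ a₂ a₃ b₀ b₁ b₂ b₃ c₀ c₁ c₂ c₃ →
      mul₂ (b₀ + c₀) (b₁ + c₁) (b₂ + c₂) (b₃ + c₃) a₀ a₁ a₂ a₃ ≡ mul₂ b₀ b₁ b₂ b₃ a₀ a₁ a₂ a₃ + mul₂ c₀ c₁ c₂ c₃ a₀ a₁ a₂ a₃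
    mul₂-distribʳ = solve-∀

    mul₃-distribʳ : ∀ a₀ a₁ a₂ a₃ b₀ b₁ b₂ b₃ c₀ c₁ c₂ c₃ →
      mul₃ (b₀ + c₀) (b₁ + c₁) (b₂ + c₂) (b₃ + c₃) a₀ a₁ a₂ a₃ ≡ mul₃ b₀ b₁ b₂ b₃ a₀ a₁ a₂ a₃ + mul₃ c₀ c₁ c₂ c₃ a₀ a₁ a₂ a₃
    mul₃-distribʳ = solve-∀

  mk-cong : ∀ {a₀ a₁ a₂ a₃ b₀ b₁ b₂ b₃} → a₀ ≡ b₀ → a₁ ≡ b₁ → a₂ ≡ b₂ → a₃ ≡ b₃ →
            mk a₀ a₁ a₂ a₃ ≡ mk b₀ b₁ b₂ b₃
  mk-cong refl refl refl refl = refl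

  infixl 6 _⊕_
  infixl 7 _⊗_

  _⊕_ : ℤ[ζ₅] → ℤ[ζ₅] → ℤ[ζ₅]
  mk a₀ a₁ a₂ a₃ ⊕ mk b₀ b₁ b₂ b₃ = mk (a₀ + b₀) (a₁ + b₁) (a₂ + b₂) (a₃ + b₃)

  _⊗_ : ℤ[ζ₅] → ℤ[ζ₅] → ℤ[ζ₅]
  mk a₀ a₁ a₂ a₃ ⊗ mk b₀ b₁ b₂ b₃ =
    mk (mul₀ a₀ a₁ a₂ a₃ b₀ b₁ b₂ b₃) (mul₁ a₀ a₁ a₂ a₃ b₀ b₁ b₂ b₃)
       (mul₂ a₀ a₁ a₂ a₃ b₀ b₁ b₂ b₃) (mul₃ a₀ a₁ a₂ a₃ b₀ b₁ b₂ b₃)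

  0ᶻ 1ᶻ : ℤ[ζ₅]
  0ᶻ = mk (+ 0) (+ 0) (+ 0) (+ 0)
  1ᶻ = mk (+ 1) (+ 0) (+ 0) (+ 0)

  ⊕-assoc : ∀ x y z → (x ⊕ y) ⊕ z ≡ x ⊕ (y ⊕ z)
  ⊕-assoc (mk a₀ a₁ a₂ a₃) (mk b₀ b₁ b₂ b₃) (mk c₀ c₁ c₂ c₃) =
    mk-cong (ℤP.+-assoc a₀ b₀ c₀) (ℤP.+-assoc a₁ b₁ c₁) (ℤP.+-assoc a₂ b₂ c₂) (ℤP.+-assoc a₃ b₃ c₃)

  ⊕-comm : ∀ x y → x ⊕ y ≡ y ⊕ x
  ⊕-comm (mk a₀ a₁ a₂ a₃) (mk b₀ b₁ b₂ b₃) =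
    mk-cong (ℤP.+-comm a₀ b₀) (ℤP.+-comm a₁ b₁) (ℤP.+-comm a₂ b₂) (ℤP.+-comm a₃ b₃)

  ⊕-identityˡ : ∀ x → 0ᶻ ⊕ x ≡ x
  ⊕-identityˡ (mk a₀ a₁ a₂ a₃) =
    mk-cong (ℤP.+-identityˡ a₀) (ℤP.+-identityˡ a₁) (ℤP.+-identityˡ a₂) (ℤP.+-identityˡ a₃)

  ⊕-identityʳ : ∀ x → x ⊕ 0ᶻ ≡ x
  ⊕-identityʳ x = trans (⊕-comm x 0ᶻ) (⊕-identityˡ x)

  ⊗-assoc : ∀ x y z → (x ⊗ y) ⊗ z ≡ x ⊗ (y ⊗ z)
  ⊗-assoc (mk a₀ a₁ a₂ a₃) (mk b₀ b₁ b₂ b₃) (mk c₀ c₁ c₂ c₃) =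
    mk-cong (mul₀-assoc a₀ a₁ a₂ a₃ b₀ b₁ b₂ b₃ c₀ c₁ c₂ c₃) (mul₁-assoc a₀ a₁ a₂ a₃ b₀ b₁ b₂ b₃ c₀ c₁ c₂ c₃)
            (mul₂-assoc a₀ a₁ a₂ a₃ b₀ b₁ b₂ b₃ c₀ c₁ c₂ c₃) (mul₃-assoc a₀ a₁ a₂ a₃ b₀ b₁ b₂ b₃ c₀ c₁ c₂ c₃)

  ⊗-comm : ∀ x y → x ⊗ y ≡ y ⊗ x
  ⊗-comm (mk a₀ a₁ a₂ a₃) (mk b₀ b₁ b₂ b₃) =
    mk-cong (mul₀-comm a₀ a₁ a₂ a₃ b₀ b₁ b₂ b₃) (mul₁-comm a₀ a₁ a₂ a₃ b₀ b₁ b₂ b₃)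
            (mul₂-comm a₀ a₁ a₂ a₃ b₀ b₁ b₂ b₃) (mul₃-comm a₀ a₁ a₂ a₃ b₀ b₁ b₂ b₃)

  ⊗-identityˡ : ∀ x → 1ᶻ ⊗ x ≡ x
  ⊗-identityˡ (mk a₀ a₁ a₂ a₃) =
    mk-cong (mul₀-identityˡ a₀ a₁ a₂ a₃) (mul₁-identityˡ a₀ a₁ a₂ a₃)
            (mul₂-identityˡ a₀ a₁ a₂ a₃) (mul₃-identityˡ a₀ a₁ a₂ a₃)

  ⊗-identityʳ : ∀ x → x ⊗ 1ᶻ ≡ x
  ⊗-identityʳ x = trans (⊗-comm x 1ᶻ) (⊗-identityˡ x)

  ⊗-zeroˡ : ∀ x → 0ᶻ ⊗ x ≡ 0ᶻ
  ⊗-zeroˡ (mk a₀ a₁ a₂ a₃) =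
    mk-cong (mul₀-zeroˡ a₀ a₁ a₂ a₃) (mul₁-zeroˡ a₀ a₁ a₂ a₃) (mul₂-zeroˡ a₀ a₁ a₂ a₃) (mul₃-zeroˡ a₀ a₁ a₂ a₃)

  ⊗-distribʳ-⊕ : ∀ x y z → (y ⊕ z) ⊗ x ≡ y ⊗ x ⊕ z ⊗ x
  ⊗-distribʳ-⊕ (mk a₀ a₁ a₂ a₃) (mk b₀ b₁ b₂ b₃) (mk c₀ c₁ c₂ c₃) =
    mk-cong (mul₀-distribʳ a₀ a₁ a₂ a₃ b₀ b₁ b₂ b₃ c₀ c₁ c₂ c₃) (mul₁-distribʳ a₀ a₁ a₂ a₃ b₀ b₁ b₂ b₃ c₀ c₁ c₂ c₃)
            (mul₂-distribʳ a₀ a₁ a₂ a₃ b₀ b₁ b₂ b₃ c₀ c₁ c₂ c₃) (mul₃-distribʳ a₀ a₁ a₂ a₃ b₀ b₁ b₂ b₃ c₀ c₁ c₂ c₃)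

  ℤ[ζ₅]-commutativeSemiring : CommutativeSemiring 0ℓ 0ℓ
  ℤ[ζ₅]-commutativeSemiring = record
    { Carrier = ℤ[ζ₅] ; _≈_ = _≡_ ; _+_ = _⊕_ ; _*_ = _⊗_ ; 0# = 0ᶻ ; 1# = 1ᶻ
    ; isCommutativeSemiring = isCommutativeSemiringˡ record
      { +-isCommutativeMonoid = record
        { isMonoid = record
          { isSemigroup = record { isMagma = record { isEquivalence = isEquivalence ; ∙-cong = cong₂ _⊕_ } ; assoc = ⊕-assoc }
          ; identity = ⊕-identityˡ , ⊕-identityʳ }
        ; comm = ⊕-comm }
      ; *-isCommutativeMonoid = record
        { isMonoid = record
          { isSemigroup = record { isMagma = record { isEquivalence = isEquivalence ; ∙-cong = cong₂ _⊗_ } ; assoc = ⊗-assoc }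
          ; identity = ⊗-identityˡ , ⊗-identityʳ }
        ; comm = ⊗-comm }
      ; distribʳ = ⊗-distribʳ-⊕
      ; zeroˡ = ⊗-zeroˡ
      }
    }

module Congruence {n : ℕ} .{{_ : NonZero n}} where
  open import Data.Nat using (_+_; _*_; _∸_; _/_; _%_)
  open import Data.Nat.DivMod using (m≡m%n+[m/n]*n; m%n≤n; %-distribˡ-+; %-distribˡ-*; %-remove-+ˡ; [m+kn]%n≡m%n)
  open import Data.Nat.Divisibility using (_∣_; ∣-refl; ∣m∣n⇒∣m+n; n∣m*n)
  import Data.Nat.Properties as ℕP
  open import Data.Nat.Tactic.RingSolver using (solve-∀)
  open import Relation.Binary.PropositionalEquality
  open ≡-Reasoning

  ≡-mod-multiple : ∀ {a b} k → a ≡ b + k * n → a ≡ b [mod n ]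
  ≡-mod-multiple {b = b} k refl = [m+kn]%n≡m%n b k n

  +-cong-mod : ∀ {a b c d} → a ≡ b [mod n ] → c ≡ d [mod n ] → a + c ≡ b + d [mod n ]
  +-cong-mod {a} {b} {c} {d} a≡b c≡d = begin
    (a + c) % n           ≡⟨ %-distribˡ-+ a c n ⟩
    (a % n + c % n) % n   ≡⟨ cong₂ (λ u v → (u + v) % n) a≡b c≡d ⟩
    (b % n + d % n) % n   ≡⟨ %-distribˡ-+ b d n ⟨
    (b + d) % n           ∎

  *-cong-mod : ∀ {a b c d} → a ≡ b [mod n ] → c ≡ d [mod n ] → a * c ≡ b * d [mod n ]
  *-cong-mod {a} {b} {c} {d} a≡b c≡d = begin
    (a * c) % n           ≡⟨ %-distribˡ-* a c n ⟩
    (a % n * (c % n)) % n ≡⟨ cong₂ (λ u v → (u * v) % n) a≡b c≡d ⟩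
    (b % n * (d % n)) % n ≡⟨ %-distribˡ-* b d n ⟨
    (b * d) % n           ∎

  +-cancelˡ-mod : ∀ a {b c} → a + b ≡ a + c [mod n ] → b ≡ c [mod n ]
  +-cancelˡ-mod a {b} {c} a+b≡a+c = begin
    b % n              ≡⟨ %-remove-+ˡ b n∣a′+a ⟨
    (a′ + a + b) % n   ≡⟨ cong (_% n) (ℕP.+-assoc a′ a b) ⟩
    (a′ + (a + b)) % n ≡⟨ +-cong-mod {a′} refl a+b≡a+c ⟩
    (a′ + (a + c)) % n ≡⟨ cong (_% n) (ℕP.+-assoc a′ a c) ⟨
    (a′ + a + c) % n   ≡⟨ %-remove-+ˡ c n∣a′+a ⟩
    c % n              ∎
    where
    a′ : ℕ
    a′ = n ∸ a % n
    a′+a≡n+[a/n]*n : a′ + a ≡ n + a / n * n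
    a′+a≡n+[a/n]*n = begin
      a′ + a                   ≡⟨ cong (a′ +_) (m≡m%n+[m/n]*n a n) ⟩
      a′ + (a % n + a / n * n) ≡⟨ ℕP.+-assoc a′ (a % n) _ ⟨
      a′ + a % n + a / n * n   ≡⟨ cong (_+ a / n * n) (ℕP.m∸n+n≡m (m%n≤n a n)) ⟩
      n + a / n * n            ∎
    n∣a′+a : n ∣ a′ + a
    n∣a′+a = subst (n ∣_) (sym a′+a≡n+[a/n]*n) (∣m∣n⇒∣m+n ∣-refl (n∣m*n (a / n)))

  *-zeroˡ-mod : ∀ {a} b → a ≡ 0 [mod n ] → a * b ≡ 0 [mod n ]
  *-zeroˡ-mod b a≡0 = *-cong-mod a≡0 (refl {x = b % n})

  *-zeroʳ-mod : ∀ a {b} → b ≡ 0 [mod n ] → a * b ≡ 0 [mod n ]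
  *-zeroʳ-mod a {b} b≡0 = trans (*-cong-mod (refl {x = a % n}) b≡0) (cong (_% n) (ℕP.*-zeroʳ a))

  square≡1 : ∀ {a} → a + 1 ≡ 0 [mod n ] → a * a ≡ 1 [mod n ]
  square≡1 {a} a+1≡0 = begin
    (a * a) % n             ≡⟨ cong (_% n) (ℕP.+-identityʳ (a * a)) ⟨
    (a * a + 0) % n         ≡⟨ +-cong-mod {a * a} refl a+1≡0 ⟨
    (a * a + (a + 1)) % n   ≡⟨ cong (_% n) (rearrange a) ⟩
    (a * (a + 1) + 1) % n   ≡⟨ +-cong-mod {c = 1} (*-zeroʳ-mod a a+1≡0) refl ⟩
    1 % n                   ∎
    where
    rearrange : ∀ x → x * x + (x + 1) ≡ x * (x + 1) + 1
    rearrange = solve-∀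

module FibonacciModPrime where
  open import Data.Integer using (ℤ; +_; -[1+_]; -_; _+_; _*_; -1ℤ)
  import Data.Integer.Properties as ℤP
  open import Data.Integer.Tactic.RingSolver using (solve-∀)
  open import Data.Nat as ℕ using (ℕ; zero; suc; NonZero)
  import Data.Nat.Properties as ℕP
  open import Data.Nat.DivMod using (_%_; _/_; m≡m%n+[m/n]*n)
  open import Data.Nat.Primality using (Prime)
  open import Data.Product using (_×_)
  open import Relation.Binary.PropositionalEquality
  open Cyclotomic
  open CommutativeSemiring ℤ[ζ₅]-commutativeSemiring using (semiring)
  open import Algebra.Properties.Semiring.Exp semiring using (_^_; ^-homo-*)
  open import Algebra.Properties.Semiring.Mult semiring using () renaming (_×_ to _·_)
  open FreshmansDream ℤ[ζ₅]-commutativeSemiring using (freshman's-dream)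
  open Congruence using (≡-mod-multiple)
  open ≡-Reasoning

  -- φ = −ζ² − ζ³ = (1 + √5)/2; numbers a + bφ have coordinates (a, 0, −b, −b), and φ̄ = 1 − φ.
  -ζ² -ζ³ φ : ℤ[ζ₅]
  -ζ² = mk (+ 0) (+ 0) -1ℤ (+ 0)
  -ζ³ = mk (+ 0) (+ 0) (+ 0) -1ℤ
  φ = -ζ² ⊕ -ζ³

  ⟨_+_φ⟩ : ℤ → ℤ → ℤ[ζ₅]
  ⟨ a + b φ⟩ = mk a (+ 0) (- b) (- b)

  φ̄ : ℤ[ζ₅]
  φ̄ = ⟨ + 1 + -1ℤ φ⟩

  φ⊗-coordinate₀ : ∀ a b → mul₀ (+ 0) (+ 0) -1ℤ -1ℤ a (+ 0) (- b) (- b) ≡ b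
  φ⊗-coordinate₀ = solve-∀
  φ⊗-coordinate₁ : ∀ a b → mul₁ (+ 0) (+ 0) -1ℤ -1ℤ a (+ 0) (- b) (- b) ≡ + 0
  φ⊗-coordinate₁ = solve-∀
  φ⊗-coordinate₂ : ∀ a b → mul₂ (+ 0) (+ 0) -1ℤ -1ℤ a (+ 0) (- b) (- b) ≡ - (b + a)
  φ⊗-coordinate₂ = solve-∀
  φ⊗-coordinate₃ : ∀ a b → mul₃ (+ 0) (+ 0) -1ℤ -1ℤ a (+ 0) (- b) (- b) ≡ - (b + a)
  φ⊗-coordinate₃ = solve-∀

  φ⊗⟨a+bφ⟩ : ∀ a b → φ ⊗ ⟨ a + b φ⟩ ≡ ⟨ b + (b + a) φ⟩
  φ⊗⟨a+bφ⟩ a b = mk-cong (φ⊗-coordinate₀ a b) (φ⊗-coordinate₁ a b) (φ⊗-coordinate₂ a b) (φ⊗-coordinate₃ a b)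

  φ^[1+n] : ∀ n → φ ^ suc n ≡ ⟨ + fib n + + fib (suc n) φ⟩
  φ^[1+n] zero = refl
  φ^[1+n] (suc n) = begin
    φ ⊗ φ ^ suc n                                  ≡⟨ cong (φ ⊗_) (φ^[1+n] n) ⟩
    φ ⊗ ⟨ + fib n + + fib (suc n) φ⟩               ≡⟨ φ⊗⟨a+bφ⟩ (+ fib n) (+ fib (suc n)) ⟩
    ⟨ + fib (suc n) + (+ fib (suc n) + + fib n) φ⟩ ≡⟨ cong ⟨ + fib (suc n) +_φ⟩ (ℤP.pos-+ (fib (suc n)) (fib n)) ⟨
    ⟨ + fib (suc n) + + fib (suc (suc n)) φ⟩       ∎

  -1ᶻ : ℤ[ζ₅]
  -1ᶻ = mk -1ℤ (+ 0) (+ 0) (+ 0)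

  -ζ²^5 : -ζ² ^ 5 ≡ -1ᶻ
  -ζ²^5 = refl

  -ζ³^5 : -ζ³ ^ 5 ≡ -1ᶻ
  -ζ³^5 = refl

  ^-antiperiodic : ∀ w → w ^ 5 ≡ -1ᶻ → ∀ r → w ^ (5 ℕ.+ r) ≡ -1ᶻ ⊗ w ^ r
  ^-antiperiodic w w⁵≡-1 r = trans (^-homo-* w 5 r) (cong (_⊗ w ^ r) w⁵≡-1)

  ^-periodic : ∀ w → w ^ 5 ≡ -1ᶻ → ∀ r j → w ^ (r ℕ.+ j ℕ.* 10) ≡ w ^ r
  ^-periodic w w⁵≡-1 r zero = cong (w ^_) (ℕP.+-identityʳ r)
  ^-periodic w w⁵≡-1 r (suc j) = begin
    w ^ (r ℕ.+ (10 ℕ.+ j ℕ.* 10))        ≡⟨ cong (w ^_) (ℕP.+-comm r (10 ℕ.+ j ℕ.* 10)) ⟩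
    w ^ (5 ℕ.+ (5 ℕ.+ (j ℕ.* 10 ℕ.+ r))) ≡⟨ ^-antiperiodic w w⁵≡-1 (5 ℕ.+ (j ℕ.* 10 ℕ.+ r)) ⟩
    -1ᶻ ⊗ w ^ (5 ℕ.+ (j ℕ.* 10 ℕ.+ r))   ≡⟨ cong (-1ᶻ ⊗_) (^-antiperiodic w w⁵≡-1 (j ℕ.* 10 ℕ.+ r)) ⟩
    -1ᶻ ⊗ (-1ᶻ ⊗ w ^ (j ℕ.* 10 ℕ.+ r))   ≡⟨ ⊗-assoc -1ᶻ -1ᶻ _ ⟨
    1ᶻ ⊗ w ^ (j ℕ.* 10 ℕ.+ r)            ≡⟨ ⊗-identityˡ _ ⟩
    w ^ (j ℕ.* 10 ℕ.+ r)                 ≡⟨ cong (w ^_) (ℕP.+-comm (j ℕ.* 10) r) ⟩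
    w ^ (r ℕ.+ j ℕ.* 10)                 ≡⟨ ^-periodic w w⁵≡-1 r j ⟩
    w ^ r                                ∎

  -ζ²³⊕-ζ³³ : -ζ² ^ 3 ⊕ -ζ³ ^ 3 ≡ φ̄
  -ζ²³⊕-ζ³³ = refl

  φ^p : ∀ {p} → Prime p → p % 10 ≡ 3 → ∃[ z ] φ ^ p ≡ φ̄ ⊕ p · z
  φ^p {p} p-prime p≡3 with freshman's-dream p-prime -ζ² -ζ³
  ... | z , dream = z , (begin
    φ ^ p                                                    ≡⟨ dream ⟩
    -ζ² ^ p ⊕ -ζ³ ^ p ⊕ p · z                                ≡⟨ cong (λ e → -ζ² ^ e ⊕ -ζ³ ^ e ⊕ p · z) p≡3+j*10 ⟩
    -ζ² ^ (3 ℕ.+ j ℕ.* 10) ⊕ -ζ³ ^ (3 ℕ.+ j ℕ.* 10) ⊕ p · z  ≡⟨ cong₂ (λ u v → u ⊕ v ⊕ p · z) (^-periodic -ζ² -ζ²^5 3 j) (^-periodic -ζ³ -ζ³^5 3 j) ⟩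
    -ζ² ^ 3 ⊕ -ζ³ ^ 3 ⊕ p · z                                ≡⟨ cong (_⊕ p · z) -ζ²³⊕-ζ³³ ⟩
    φ̄ ⊕ p · z                                                ∎)
    where
    j : ℕ
    j = p / 10
    p≡3+j*10 : p ≡ 3 ℕ.+ j ℕ.* 10
    p≡3+j*10 = trans (m≡m%n+[m/n]*n p 10) (cong (ℕ._+ j ℕ.* 10) p≡3)

  ·-mk : ∀ n a₀ a₁ a₂ a₃ → n · mk a₀ a₁ a₂ a₃ ≡ mk (+ n * a₀) (+ n * a₁) (+ n * a₂) (+ n * a₃)
  ·-mk zero a₀ a₁ a₂ a₃ = refl
  ·-mk (suc n) a₀ a₁ a₂ a₃ = begin
    mk a₀ a₁ a₂ a₃ ⊕ n · mk a₀ a₁ a₂ a₃                                 ≡⟨ cong (mk a₀ a₁ a₂ a₃ ⊕_) (·-mk n a₀ a₁ a₂ a₃) ⟩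
    mk (a₀ + + n * a₀) (a₁ + + n * a₁) (a₂ + + n * a₂) (a₃ + + n * a₃) ≡⟨ mk-cong (suc-* a₀) (suc-* a₁) (suc-* a₂) (suc-* a₃) ⟨
    mk (+ suc n * a₀) (+ suc n * a₁) (+ suc n * a₂) (+ suc n * a₃)     ∎
    where
    suc-* : ∀ a → + suc n * a ≡ a + + n * a
    suc-* = ℤP.suc-* (+ n)

  +-injective-multiple : ∀ {a b n c} → + a ≡ + b + + n * + c → a ≡ b ℕ.+ c ℕ.* n
  +-injective-multiple {a} {b} {n} {c} a≡b+nc = ℤP.+-injective (begin
    + a                   ≡⟨ a≡b+nc ⟩
    + b + + n * + c       ≡⟨ cong (λ x → + b + x) (ℤP.*-comm (+ n) (+ c)) ⟩
    + b + + c * + n       ≡⟨ cong (λ x → + b + x) (ℤP.pos-* c n) ⟨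
    + b + + (c ℕ.* n)     ≡⟨ ℤP.pos-+ b (c ℕ.* n) ⟨
    + (b ℕ.+ c ℕ.* n)     ∎)

  ≡-mod-fromℤ : ∀ {a b n} .{{_ : NonZero n}} z → + a ≡ + b + + n * z → a ≡ b [mod n ]
  ≡-mod-fromℤ {a} {b} {n} (+ c) a≡b+nc = ≡-mod-multiple c (+-injective-multiple {a} {b} {n} {c} a≡b+nc)
  ≡-mod-fromℤ {a} {b} {n} -[1+ c ] a≡b-n[1+c] = sym (≡-mod-multiple (suc c) (+-injective-multiple {b} {a} {n} {suc c} (begin
    + b                               ≡⟨ cancel (+ b) (+ n) (+ suc c) ⟩
    + b + + n * -[1+ c ] + + n * + suc c ≡⟨ cong (_+ + n * + suc c) a≡b-n[1+c] ⟨
    + a + + n * + suc c               ∎)))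
    where
    cancel : ∀ x y w → x ≡ x + y * - w + y * w
    cancel = solve-∀

  fib-prime : ∀ {p} → Prime (suc p) → suc p % 10 ≡ 3 →
              fib p ≡ 1 [mod suc p ] × fib (suc p) ℕ.+ 1 ≡ 0 [mod suc p ]
  fib-prime {p} p-prime p≡3 with φ^p p-prime p≡3
  ... | mk z₀ z₁ z₂ z₃ , φᵖ≡φ̄+pz =
    ≡-mod-fromℤ {fib p} {1} {suc p} z₀ (cong (λ { (mk a _ _ _) → a }) φᵖ) ,
    ≡-mod-fromℤ {fib (suc p) ℕ.+ 1} {0} {suc p} (- z₂) (trans (ℤP.pos-+ (fib (suc p)) 1) (negate {+ fib (suc p)} {+ suc p} {z₂} (cong (λ { (mk _ _ a _) → a }) φᵖ)))
    where
    φᵖ : ⟨ + fib p + + fib (suc p) φ⟩ ≡ φ̄ ⊕ mk (+ suc p * z₀) (+ suc p * z₁) (+ suc p * z₂) (+ suc p * z₃)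
    φᵖ = trans (sym (φ^[1+n] p)) (trans φᵖ≡φ̄+pz (cong (φ̄ ⊕_) (·-mk (suc p) z₀ z₁ z₂ z₃)))
    negate : ∀ {u v w} → - u ≡ + 1 + v * w → u + + 1 ≡ + 0 + v * - w
    negate {u} {v} {w} -u≡1+vw = begin
      u + + 1               ≡⟨ cong (_+ + 1) (ℤP.neg-involutive u) ⟨
      - - u + + 1           ≡⟨ cong (λ x → - x + + 1) -u≡1+vw ⟩
      - (+ 1 + v * w) + + 1 ≡⟨ rearrange v w ⟩
      + 0 + v * - w         ∎
      where
      rearrange : ∀ v w → - (+ 1 + v * w) + + 1 ≡ + 0 + v * - w
      rearrange = solve-∀

module FibonacciPeriods where
  open import Data.Nat using (_+_; _*_; _%_)
  open import Data.Product using (_×_)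
  import Data.Nat.Properties as ℕP
  open import Data.Nat.Tactic.RingSolver using (solve-∀)
  open import Relation.Binary.PropositionalEquality
  open Congruence
  open ≡-Reasoning

  fib-suc-+ : ∀ m n → fib (suc (m + n)) ≡ fib (suc m) * fib (suc n) + fib m * fib n
  fib-suc-+ zero n = sym (trans (ℕP.+-identityʳ _) (ℕP.+-identityʳ _))
  fib-suc-+ (suc m) n = begin
    fib (suc (suc m + n))                                      ≡⟨ cong (λ i → fib (suc i)) (ℕP.+-suc m n) ⟨
    fib (suc (m + suc n))                                      ≡⟨ fib-suc-+ m (suc n) ⟩
    fib (suc m) * (fib (suc n) + fib n) + fib m * fib (suc n)  ≡⟨ regroup (fib (suc m)) (fib m) (fib (suc n)) (fib n) ⟩
    (fib (suc m) + fib m) * fib (suc n) + fib (suc m) * fib n  ∎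
    where
    regroup : ∀ a b c d → a * (c + d) + b * c ≡ (a + b) * c + a * d
    regroup = solve-∀

  -- The conclusion of the theorem for a = (5k + 4)/3, b = 2a, c = a − 1 and d = 3a.
  PeriodCriteria : (n : ℕ) .{{_ : NonZero n}} → ℕ → ℕ → ℕ → ℕ → Set
  PeriodCriteria n a b c d =
    (IsFibPeriod n b → ((fib d ≡ 0 [mod n ]) ⇔ (fib a ≡ 0 [mod n ])) × ((fib a ≡ 0 [mod n ]) ⇔ (fib b ≡ 0 [mod n ])))
    × (fib a ≡ 0 [mod n ] → IsFibPeriod n b ⇔ (fib c + 1 ≡ 0 [mod n ]))

  module _ {n} .{{_ : NonZero n}} where

    fib-suc-suc≡0 : ∀ {i} → fib i ≡ 1 [mod n ] → fib (suc i) + 1 ≡ 0 [mod n ] → fib (suc (suc i)) ≡ 0 [mod n ]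
    fib-suc-suc≡0 {i} fib[i]≡1 fib[1+i]+1≡0 = trans (+-cong-mod {a = fib (suc i)} refl fib[i]≡1) fib[1+i]+1≡0

    module _ {ℓ} (period : IsFibPeriod n ℓ) where

      period⇒fib≡0 : fib ℓ ≡ 0 [mod n ]
      period⇒fib≡0 = +-cancelˡ-mod (fib (suc ℓ)) (trans (proj₂ period) (sym (trans (cong (_% n) (ℕP.+-identityʳ _)) (proj₁ period))))

      fib-periodic : ∀ i → fib (i + ℓ) ≡ fib i [mod n ]
      fib-periodic zero = period⇒fib≡0
      fib-periodic (suc zero) = proj₁ period
      fib-periodic (suc (suc i)) = +-cong-mod (fib-periodic (suc i)) (fib-periodic i)

    module _ (m : ℕ) where

      fib[2m+2]≡0 : fib (suc m) ≡ 0 [mod n ] → fib (suc m + suc m) ≡ 0 [mod n ]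
      fib[2m+2]≡0 fib[m+1]≡0 = begin
        fib (suc m + suc m) % n                                     ≡⟨ cong (_% n) (fib-suc-+ m (suc m)) ⟩
        (fib (suc m) * fib (suc (suc m)) + fib m * fib (suc m)) % n ≡⟨ +-cong-mod (*-zeroˡ-mod _ fib[m+1]≡0) (*-zeroʳ-mod (fib m) fib[m+1]≡0) ⟩
        0 % n                                                       ∎

      fib[m]+1≡0⇒period : fib (suc m) ≡ 0 [mod n ] → fib m + 1 ≡ 0 [mod n ] → IsFibPeriod n (suc m + suc m)
      fib[m]+1≡0⇒period fib[m+1]≡0 fib[m]+1≡0 = fib[2m+3]≡1 , +-cong-mod fib[2m+3]≡1 (fib[2m+2]≡0 fib[m+1]≡0)
        where
        fib[m+2]≡fib[m] : fib (suc (suc m)) ≡ fib m [mod n ]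
        fib[m+2]≡fib[m] = +-cong-mod fib[m+1]≡0 refl
        fib[2m+3]≡1 : fib (suc (suc m + suc m)) ≡ 1 [mod n ]
        fib[2m+3]≡1 = begin
          fib (suc (suc m + suc m)) % n                                           ≡⟨ cong (_% n) (fib-suc-+ (suc m) (suc m)) ⟩
          (fib (suc (suc m)) * fib (suc (suc m)) + fib (suc m) * fib (suc m)) % n ≡⟨ +-cong-mod (*-cong-mod fib[m+2]≡fib[m] fib[m+2]≡fib[m]) (*-zeroˡ-mod _ fib[m+1]≡0) ⟩
          (fib m * fib m + 0) % n                                                 ≡⟨ cong (_% n) (ℕP.+-identityʳ _) ⟩
          (fib m * fib m) % n                                                     ≡⟨ square≡1 fib[m]+1≡0 ⟩
          1 % n                                                                   ∎

      -- Here m + 2(m + 1) plays the role of the prime p = 5k + 3.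
      period-criteria : fib (m + (suc m + suc m)) + 1 ≡ 0 [mod n ] → fib (suc m + (suc m + suc m)) ≡ 0 [mod n ] →
                        PeriodCriteria n (suc m) (suc m + suc m) m (suc m + (suc m + suc m))
      period-criteria fib[p]+1≡0 fib[p+1]≡0 =
        (λ period → mk⇔ (const (period⇒fib[m+1]≡0 period)) (const fib[p+1]≡0)
                  , mk⇔ (const (fib[2m+2]≡0 (period⇒fib[m+1]≡0 period))) (const (period⇒fib[m+1]≡0 period)))
        , λ fib[m+1]≡0 → mk⇔ period⇒fib[m]+1≡0 (fib[m]+1≡0⇒period fib[m+1]≡0)
        where
        period⇒fib[m+1]≡0 : IsFibPeriod n (suc m + suc m) → fib (suc m) ≡ 0 [mod n ]
        period⇒fib[m+1]≡0 period = trans (sym (fib-periodic period (suc m))) fib[p+1]≡0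
        period⇒fib[m]+1≡0 : IsFibPeriod n (suc m + suc m) → fib m + 1 ≡ 0 [mod n ]
        period⇒fib[m]+1≡0 period = trans (+-cong-mod (sym (fib-periodic period m)) refl) fib[p]+1≡0

open import Data.Nat using (ℕ; suc; _+_; _*_; _/_; _%_; _>_; NonZero)
open import Data.Nat.Primality using (Prime)
open import Data.Product using (_×_)
open import Function.Bundles using (_⇔_)
open import Relation.Binary.PropositionalEquality using (_≡_)

open import Data.Nat.DivMod using (m≡m%n+[m/n]*n; m*n/n≡m; [m+kn]%n≡m%n)
open import Data.Nat.Properties using (+-suc)
open import Data.Nat.Tactic.RingSolver using (solve-∀)
open import Relation.Binary.PropositionalEquality using (refl; trans; cong; subst; module ≡-Reasoning)
open FibonacciModPrime using (fib-prime)
open FibonacciPeriods using (PeriodCriteria; period-criteria; fib-suc-suc≡0)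

5k+3≡3[mod10] : ∀ {k} → k % 2 ≡ 0 → suc (5 * k + 2) % 10 ≡ 3
5k+3≡3[mod10] {k} k-even = begin
  suc (5 * k + 2) % 10           ≡⟨ cong (λ x → suc (5 * x + 2) % 10) k≡2j ⟩
  suc (5 * (0 + j * 2) + 2) % 10 ≡⟨ cong (_% 10) (rearrange j) ⟩
  (3 + j * 10) % 10              ≡⟨ [m+kn]%n≡m%n 3 j 10 ⟩
  3                              ∎
  where
  open ≡-Reasoning
  j : ℕ
  j = k / 2
  k≡2j : k ≡ 0 + j * 2
  k≡2j = trans (m≡m%n+[m/n]*n k 2) (cong (_+ j * 2) k-even)
  rearrange : ∀ j → suc (5 * (0 + j * 2) + 2) ≡ 3 + j * 10
  rearrange = solve-∀

k≡1[mod3]⇒indices : ∀ {k} → k % 3 ≡ 1 → ∃[ m ]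
  ( (5 * k + 4) / 3 ≡ suc m × 2 * (5 * k + 4) / 3 ≡ suc m + suc m × (5 * k + 1) / 3 ≡ m
  × 5 * k + 4 ≡ suc m + (suc m + suc m) × suc (5 * k + 2) ≡ m + (suc m + suc m))
k≡1[mod3]⇒indices {k} k≡1 =
  m , /3 (in-q (λ x → 5 * x + 4) I₁) , /3 (in-q (λ x → 2 * (5 * x + 4)) I₂) , /3 (in-q (λ x → 5 * x + 1) I₃)
    , in-q (λ x → 5 * x + 4) I₄ , in-q (λ x → suc (5 * x + 2)) I₅
  where
  q m : ℕ
  q = k / 3
  m = 5 * q + 2
  k≡1+3q : k ≡ 1 + q * 3
  k≡1+3q = trans (m≡m%n+[m/n]*n k 3) (cong (_+ q * 3) k≡1)
  in-q : ∀ (f : ℕ → ℕ) {g : ℕ → ℕ} → (∀ q → f (1 + q * 3) ≡ g q) → f k ≡ g q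
  in-q f f≡g = trans (cong f k≡1+3q) (f≡g q)
  /3 : ∀ {x y} → x ≡ y * 3 → x / 3 ≡ y
  /3 {y = y} refl = m*n/n≡m y 3
  I₁ : ∀ q → 5 * (1 + q * 3) + 4 ≡ suc (5 * q + 2) * 3
  I₁ = solve-∀
  I₂ : ∀ q → 2 * (5 * (1 + q * 3) + 4) ≡ (suc (5 * q + 2) + suc (5 * q + 2)) * 3
  I₂ = solve-∀
  I₃ : ∀ q → 5 * (1 + q * 3) + 1 ≡ (5 * q + 2) * 3
  I₃ = solve-∀
  I₄ : ∀ q → 5 * (1 + q * 3) + 4 ≡ suc (5 * q + 2) + (suc (5 * q + 2) + suc (5 * q + 2))
  I₄ = solve-∀
  I₅ : ∀ q → suc (5 * (1 + q * 3) + 2) ≡ 5 * q + 2 + (suc (5 * q + 2) + suc (5 * q + 2))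
  I₅ = solve-∀

theorem5p37 : (k : ℕ) → k > 0 → k % 2 ≡ 0 → Prime (5 * k + 3) →
    (k % 3 ≡ 1 → IsFibPeriod (suc (5 * k + 2)) (2 * (5 * k + 4) / 3) →
      ((fib (5 * k + 4) ≡ 0 [mod suc (5 * k + 2) ]) ⇔ (fib ((5 * k + 4) / 3) ≡ 0 [mod suc (5 * k + 2) ]))
      × ((fib ((5 * k + 4) / 3) ≡ 0 [mod suc (5 * k + 2) ]) ⇔ (fib (2 * (5 * k + 4) / 3) ≡ 0 [mod suc (5 * k + 2) ])))
    × (k % 3 ≡ 1 → fib ((5 * k + 4) / 3) ≡ 0 [mod suc (5 * k + 2) ] →
      (IsFibPeriod (suc (5 * k + 2)) (2 * (5 * k + 4) / 3)) ⇔ (fib ((5 * k + 1) / 3) + 1 ≡ 0 [mod suc (5 * k + 2) ]))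
theorem5p37 k _ k-even p-prime = (λ k≡1 → proj₁ (criteria k≡1)) , (λ k≡1 → proj₂ (criteria k≡1))
  where
  p : ℕ
  p = suc (5 * k + 2)

  fib[p-1]≡1×fib[p]+1≡0 : fib (5 * k + 2) ≡ 1 [mod p ] × fib p + 1 ≡ 0 [mod p ]
  fib[p-1]≡1×fib[p]+1≡0 = fib-prime (subst Prime (+-suc (5 * k) 2) p-prime) (5k+3≡3[mod10] {k} k-even)

  fib[p+1]≡0 : fib (suc p) ≡ 0 [mod p ]
  fib[p+1]≡0 = fib-suc-suc≡0 {i = 5 * k + 2} (proj₁ fib[p-1]≡1×fib[p]+1≡0) (proj₂ fib[p-1]≡1×fib[p]+1≡0)

  criteria : k % 3 ≡ 1 → PeriodCriteria p ((5 * k + 4) / 3) (2 * (5 * k + 4) / 3) ((5 * k + 1) / 3) (5 * k + 4)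
  criteria k≡1 with k≡1[mod3]⇒indices {k} k≡1
  ... | m , a≡ , b≡ , c≡ , d≡ , p≡ rewrite a≡ | b≡ | c≡ | d≡ =
    period-criteria m (subst (λ i → fib i + 1 ≡ 0 [mod p ]) p≡ (proj₂ fib[p-1]≡1×fib[p]+1≡0))
                      (subst (λ i → fib (suc i) ≡ 0 [mod p ]) p≡ fib[p+1]≡0)
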